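{- Let $\mathcal{C}$ be an elementary topos, let $\phi\colon L\to A$ be an arrow in $\mathcal{C}$ and let $L\xrightarrow{\eta_\phi}\overline{\phi}\to A$ be its materialization (the terminal object of the materialization category $\mathrm{Mat}(\phi)$). Then \[\mathcal{L}(L\xrightarrow{\eta_\phi}\overline{\phi})=\{\,L\xrightarrow{m_L}X \text{ mono}\mid \exists\,\psi\colon X\to A.\ \phi=\psi\circ m_L\,\}.\]
   Context: The materialization category $\mathrm{Mat}(\phi)$ has as objects all factorizations $L\xrightarrow{m}X\xrightarrow{\psi}A$ of $\phi$ with $m$ mono; an arrow from $L\xrightarrow{m}X\xrightarrow{\psi}A$ to $L\xrightarrow{m'}Y\xrightarrow{\psi'}A$ is an arrow $f\colon X\to Y$ with $\psi'\circ f=\psi$ such that the square $f\circ m=m'\circ\mathrm{id}_L$ is a pullback. Its terminal object (which exists in a topos) is the materialization. For a mono $\theta\colon L\rightarrowtail B$, the language $\mathcal{L}(\theta)$ is the set of all monos $m\colon L\rightarrowtail X$ for which there exists an arrow $\psi\colon X\to B$ such that the square with $m\colon L\to X$, $\mathrm{id}_L\colon L\to L$, $\psi\colon X\to B$, $\theta\colon L\to B$ (so $\psi\circ m=\theta$) is a pullback. ($\mathcal{C}$ is assumed essentially small.) -}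

module Defs where

open import Level using (Level; _⊔_; suc)
open import Data.Product using (Σ; _×_; _,_; ∃; ∃-syntax)
open import Relation.Binary.Structures using (IsEquivalence)

record Category (o ℓ e : Level) : Set (suc (o ⊔ ℓ ⊔ e)) where
  infixr 9 _∘_
  infix  4 _≈_
  infix  5 _⇒_
  field
    Obj   : Set o
    _⇒_   : Obj → Obj → Set ℓ
    _≈_   : ∀ {A B} → A ⇒ B → A ⇒ B → Set e
    id    : ∀ {A} → A ⇒ A
    _∘_   : ∀ {A B C} → B ⇒ C → A ⇒ B → A ⇒ C
    equiv : ∀ {A B} → IsEquivalence (_≈_ {A} {B})
    ∘-resp-≈ : ∀ {A B C} {f h : B ⇒ C} {g i : A ⇒ B} → f ≈ h → g ≈ i → f ∘ g ≈ h ∘ i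
    assoc : ∀ {A B C D} {f : A ⇒ B} {g : B ⇒ C} {h : C ⇒ D} → (h ∘ g) ∘ f ≈ h ∘ (g ∘ f)
    identityˡ : ∀ {A B} {f : A ⇒ B} → id ∘ f ≈ f
    identityʳ : ∀ {A B} {f : A ⇒ B} → f ∘ id ≈ f

module CatDefs {o ℓ e : Level} (𝒞 : Category o ℓ e) where
  open Category 𝒞

  Mono : ∀ {A B} → A ⇒ B → Set (o ⊔ ℓ ⊔ e)
  Mono {A} f = ∀ {Z} (g h : Z ⇒ A) → f ∘ g ≈ f ∘ h → g ≈ h

  record IsPullback {P X Y Z : Obj} (p₁ : P ⇒ X) (p₂ : P ⇒ Y)
                    (f : X ⇒ Z) (g : Y ⇒ Z) : Set (o ⊔ ℓ ⊔ e) where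
    field
      commute   : f ∘ p₁ ≈ g ∘ p₂
      universal : ∀ {Q} (q₁ : Q ⇒ X) (q₂ : Q ⇒ Y) → f ∘ q₁ ≈ g ∘ q₂ →
                  Σ (Q ⇒ P) λ u → (p₁ ∘ u ≈ q₁) × (p₂ ∘ u ≈ q₂)
      unique    : ∀ {Q} (u v : Q ⇒ P) → p₁ ∘ u ≈ p₁ ∘ v → p₂ ∘ u ≈ p₂ ∘ v → u ≈ v

  record Terminal : Set (o ⊔ ℓ ⊔ e) where
    field
      ⊤      : Obj
      !      : ∀ {A} → A ⇒ ⊤
      !-uniq : ∀ {A} (f : A ⇒ ⊤) → f ≈ !

  record Pullbacks : Set (o ⊔ ℓ ⊔ e) where
    field
      P  : ∀ {X Y Z} → X ⇒ Z → Y ⇒ Z → Obj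
      p₁ : ∀ {X Y Z} (f : X ⇒ Z) (g : Y ⇒ Z) → P f g ⇒ X
      p₂ : ∀ {X Y Z} (f : X ⇒ Z) (g : Y ⇒ Z) → P f g ⇒ Y
      isPullback : ∀ {X Y Z} (f : X ⇒ Z) (g : Y ⇒ Z) → IsPullback (p₁ f g) (p₂ f g) f g

  record BinaryProducts : Set (o ⊔ ℓ ⊔ e) where
    infixr 7 _×ₒ_
    field
      _×ₒ_ : Obj → Obj → Obj
      π₁   : ∀ {A B} → A ×ₒ B ⇒ A
      π₂   : ∀ {A B} → A ×ₒ B ⇒ B
      ⟨_,_⟩ : ∀ {C A B} → C ⇒ A → C ⇒ B → C ⇒ A ×ₒ B
      project₁ : ∀ {C A B} {f : C ⇒ A} {g : C ⇒ B} → π₁ ∘ ⟨ f , g ⟩ ≈ f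
      project₂ : ∀ {C A B} {f : C ⇒ A} {g : C ⇒ B} → π₂ ∘ ⟨ f , g ⟩ ≈ g
      unique   : ∀ {C A B} {h : C ⇒ A ×ₒ B} {f : C ⇒ A} {g : C ⇒ B} →
                 π₁ ∘ h ≈ f → π₂ ∘ h ≈ g → ⟨ f , g ⟩ ≈ h

  module _ (prods : BinaryProducts) where
    open BinaryProducts prods

    _⁂_ : ∀ {A B C D} → A ⇒ B → C ⇒ D → A ×ₒ C ⇒ B ×ₒ D
    f ⁂ g = ⟨ f ∘ π₁ , g ∘ π₂ ⟩

    record Exponentials : Set (o ⊔ ℓ ⊔ e) where
      infixr 8 _^_
      field
        _^_   : Obj → Obj → Obj
        eval  : ∀ {B C} → (C ^ B) ×ₒ B ⇒ C
        λg    : ∀ {X B C} → X ×ₒ B ⇒ C → X ⇒ C ^ B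
        β     : ∀ {X B C} {f : X ×ₒ B ⇒ C} → eval ∘ (λg f ⁂ id) ≈ f
        λ-unique : ∀ {X B C} {f : X ×ₒ B ⇒ C} {h : X ⇒ C ^ B} →
                   eval ∘ (h ⁂ id) ≈ f → h ≈ λg f

  module _ (term : Terminal) where
    open Terminal term

    record SubobjectClassifier : Set (o ⊔ ℓ ⊔ e) where
      field
        Ω    : Obj
        true : ⊤ ⇒ Ω
        χ    : ∀ {U X} (m : U ⇒ X) → Mono m → X ⇒ Ω
        χ-pullback : ∀ {U X} (m : U ⇒ X) (mono : Mono m) → IsPullback m ! (χ m mono) true
        χ-unique : ∀ {U X} (m : U ⇒ X) (mono : Mono m) (c : X ⇒ Ω) →
                   IsPullback m ! c true → c ≈ χ m mono

record Topos (o ℓ e : Level) : Set (suc (o ⊔ ℓ ⊔ e)) where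
  field
    cat : Category o ℓ e
  open CatDefs cat public
  field
    terminal  : Terminal
    pullbacks : Pullbacks
    products  : BinaryProducts
    exponentials : Exponentials products
    classifier   : SubobjectClassifier terminal

module MatDefs {o ℓ e : Level} (𝒞 : Category o ℓ e) where
  open Category 𝒞
  open CatDefs 𝒞

  record MatObj {L A : Obj} (φ : L ⇒ A) : Set (o ⊔ ℓ ⊔ e) where
    field
      X      : Obj
      m      : L ⇒ X
      ψ      : X ⇒ A
      m-mono : Mono m
      factor : ψ ∘ m ≈ φ

  record MatHom {L A : Obj} {φ : L ⇒ A} (S T : MatObj φ) : Set (o ⊔ ℓ ⊔ e) where
    private
      module S = MatObj S
      module T = MatObj T
    field
      f        : S.X ⇒ T.X
      over     : T.ψ ∘ f ≈ S.ψ
      pullback : IsPullback S.m id f T.m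

  record IsTerminalMat {L A : Obj} {φ : L ⇒ A} (T : MatObj φ) : Set (o ⊔ ℓ ⊔ e) where
    field
      !      : (S : MatObj φ) → MatHom S T
      !-uniq : (S : MatObj φ) (h : MatHom S T) → MatHom.f h ≈ MatHom.f (! S)

  InLanguage : ∀ {L B X : Obj} (θ : L ⇒ B) (m : L ⇒ X) → Set (o ⊔ ℓ ⊔ e)
  InLanguage {L} {B} {X} θ m =
    Mono m × Σ (X ⇒ B) λ ψ → IsPullback m id ψ θ

module Submission where

-- The argument uses no topos structure beyond the existence of the
-- materialization, so both inclusions are proved in an arbitrary category:
--   * (⊆) A member  m  of  ℒ(θ)  comes with  ψ  such that  ψ ∘ m ≈ θ ; hence
--     any arrow  ρ ∘ θ  factors through  m  as  (ρ ∘ ψ) ∘ m .  Applied to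
--     θ = η  and  ρ = ψ_φ̄  (with  ψ_φ̄ ∘ η ≈ φ) this gives the factorization.
--   * (⊇) A mono  m  with  φ ≈ ψ ∘ m  is an object of  Mat(φ) ; the unique
--     arrow from it into the terminal object of  Mat(φ)  is, by definition of
--     the arrows of  Mat(φ) , a pullback square witnessing  m ∈ ℒ(η) .

open import Level using (Level)
open import Data.Product using (Σ; _×_; _,_)
open import Relation.Binary.Bundles using (Setoid)
open import Relation.Binary.Structures using (IsEquivalence)
import Relation.Binary.Reasoning.Setoid as SetoidReasoning
open import Defs

module MaterializationLanguage {o ℓ e : Level} (𝒞 : Category o ℓ e) where
  open Category 𝒞
  open CatDefs 𝒞
  open MatDefs 𝒞

  hom-setoid : Obj → Obj → Setoid ℓ e
  hom-setoid A B = record { Carrier = A ⇒ B ; _≈_ = _≈_ ; isEquivalence = equiv }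
  ≈-refl : ∀ {A B} {f : A ⇒ B} → f ≈ f
  ≈-refl = IsEquivalence.refl equiv

  factor-through-language-member :
    ∀ {L B X A} {θ : L ⇒ B} {m : L ⇒ X} {ψ : X ⇒ B} (ρ : B ⇒ A) →
    IsPullback m id ψ θ → ρ ∘ θ ≈ (ρ ∘ ψ) ∘ m
  factor-through-language-member {L} {A = A} {θ} {m} {ψ} ρ pb = begin
    ρ ∘ θ          ≈⟨ ∘-resp-≈ ≈-refl identityʳ ⟨
    ρ ∘ (θ ∘ id)   ≈⟨ ∘-resp-≈ ≈-refl (IsPullback.commute pb) ⟨
    ρ ∘ (ψ ∘ m)    ≈⟨ assoc ⟨
    (ρ ∘ ψ) ∘ m    ∎
    where open SetoidReasoning (hom-setoid L A)

  factorization-object : ∀ {L A X} {φ : L ⇒ A} (m : L ⇒ X) → Mono m →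
                         (ψ : X ⇒ A) → φ ≈ ψ ∘ m → MatObj φ
  factorization-object m mono ψ φ≈ψ∘m = record
    { X = _ ; m = m ; ψ = ψ ; m-mono = mono ; factor = sym φ≈ψ∘m }
    where open IsEquivalence equiv using (sym)

  -- The embedding of every object of  Mat(φ)  lies in the language of the
  -- embedding of a terminal object: the arrow into it is a pullback square.
  terminal-classifies : ∀ {L A} {φ : L ⇒ A} {T : MatObj φ} → IsTerminalMat T →
                        (S : MatObj φ) → InLanguage (MatObj.m T) (MatObj.m S)
  terminal-classifies terminal S =
    MatObj.m-mono S , MatHom.f to-T , MatHom.pullback to-T
    where to-T = IsTerminalMat.! terminal S

proposition11 : ∀ {o ℓ e : Level} (𝒯 : Topos o ℓ e) →
    let open Topos 𝒯
        open Category cat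
        open MatDefs cat
    in
    ∀ {L A : Obj} (φ : L ⇒ A) (M : MatObj φ) → IsTerminalMat M →
    ∀ {X : Obj} (m : L ⇒ X) →
      (InLanguage (MatObj.m M) m → Mono m × Σ (X ⇒ A) (λ ψ → φ ≈ ψ ∘ m))
      × (Mono m × Σ (X ⇒ A) (λ ψ → φ ≈ ψ ∘ m) → InLanguage (MatObj.m M) m)
proposition11 𝒯 {A = A} φ M M-terminal {X} m =
  language⊆factorizations , factorizations⊆language
  where
  open Topos 𝒯
  open Category cat
  open MatDefs cat using (InLanguage)
  open MaterializationLanguage cat
  module M = MatDefs.MatObj M
  open IsEquivalence equiv using (sym; trans)

  language⊆factorizations : InLanguage M.m m → Mono m × Σ (X ⇒ A) (λ ψ → φ ≈ ψ ∘ m)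
  language⊆factorizations (mono , ψ , pb) = mono , M.ψ ∘ ψ ,
    trans (sym M.factor) (factor-through-language-member M.ψ pb)

  factorizations⊆language : Mono m × Σ (X ⇒ A) (λ ψ → φ ≈ ψ ∘ m) → InLanguage M.m m
  factorizations⊆language (mono , ψ , φ≈ψ∘m) =
    terminal-classifies M-terminal (factorization-object m mono ψ φ≈ψ∘m)
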